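{- A pseudo-Kleene lattice $\mathbf A$ is sp-orthomodular if and only if it satisfies the identity $(x\lor y)\land(x\lor x')\approx x\lor((x\lor y)\land x')$.
   Context: A pseudo-Kleene lattice is an algebra $(A,\land,\lor,{}',0,1)$ where $(A,\land,\lor,0,1)$ is a bounded lattice, ${}'$ is an antitone involution, and $x\land x'\leq y\lor y'$ for all $x,y$. It is sp-orthomodular if for all $x,y$: (SP1) $x\leq y$ and $x'\land y=(x\land x')\lor(y\land y')$ imply $y\land(x\lor x')=x\lor(y\land y')$; (SP2) $x\leq y$ implies $(x\land x')\lor(y\land y')=(x'\land y)\land(x'\land y)'$. -}

module Defs where

open import Level using (Level; _⊔_; suc)
open import Relation.Binary.Lattice.Bundles using (BoundedLattice)

record PseudoKleeneLattice (c ℓ₁ ℓ₂ : Level) : Set (suc (c ⊔ ℓ₁ ⊔ ℓ₂)) where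
  field
    boundedLattice : BoundedLattice c ℓ₁ ℓ₂
  open BoundedLattice boundedLattice public
  infix 8 _′
  field
    _′         : Carrier → Carrier
    antitone   : ∀ {x y} → x ≤ y → (y ′) ≤ (x ′)
    involutive : ∀ x → ((x ′) ′) ≈ x
    kleene     : ∀ x y → (x ∧ (x ′)) ≤ (y ∨ (y ′))

module _ {c ℓ₁ ℓ₂} (A : PseudoKleeneLattice c ℓ₁ ℓ₂) where
  open PseudoKleeneLattice A

  SP1 : Set (c ⊔ ℓ₁ ⊔ ℓ₂)
  SP1 = ∀ x y → x ≤ y →
        ((x ′) ∧ y) ≈ ((x ∧ (x ′)) ∨ (y ∧ (y ′))) →
        (y ∧ (x ∨ (x ′))) ≈ (x ∨ (y ∧ (y ′)))

  SP2 : Set (c ⊔ ℓ₁ ⊔ ℓ₂)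
  SP2 = ∀ x y → x ≤ y →
        ((x ∧ (x ′)) ∨ (y ∧ (y ′))) ≈ (((x ′) ∧ y) ∧ (((x ′) ∧ y) ′))

  SpOrthomodular : Set (c ⊔ ℓ₁ ⊔ ℓ₂)
  SpOrthomodular = SP1 × SP2
    where open import Data.Product using (_×_)

  Identity : Set (c ⊔ ℓ₁)
  Identity = ∀ x y → ((x ∨ y) ∧ (x ∨ (x ′))) ≈ (x ∨ ((x ∨ y) ∧ (x ′)))

-- Both conditions are equivalent to the inequality z ∧ (x ∨ x′) ≤ x ∨ (z ∧ x′)
-- for x ≤ z, which is the identity at z = x ∨ y; the reverse inequality holds
-- in every lattice with an antitone involution.  Applying ′ turns this
-- inequality into its order dual y ∧ (x ∨ y′) ≤ x ∨ (y ∧ y′) for x ≤ y, and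
-- (SP1), (SP2) follow by direct estimates from the two.  Conversely, given
-- (SP1) and (SP2), let w = x ∨ (z ∧ x′), so x ≤ w ≤ z.  The element w′ ∧ z
-- lies below its own complement, so (SP2) for w ≤ z supplies the premise of
-- (SP1), giving z ∧ (w ∨ w′) ≈ w ∨ (z ∧ z′) ≤ w; and (SP2) for x ≤ z gives
-- z ∧ (x ∨ x′) ≤ w ∨ w′.
module Submission where

open import Defs
open import Level using (Level; _⊔_)
open import Data.Product using (_,_)
open import Function.Bundles using (_⇔_; mk⇔)
import Relation.Binary.Lattice.Properties.JoinSemilattice as JoinSemilatticeProperties
import Relation.Binary.Lattice.Properties.MeetSemilattice as MeetSemilatticeProperties
import Relation.Binary.Reasoning.PartialOrder as ≤-Reasoning

module SpOrthomodularity {c ℓ₁ ℓ₂} (A : PseudoKleeneLattice c ℓ₁ ℓ₂) where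
  open PseudoKleeneLattice A
  open JoinSemilatticeProperties joinSemilattice using (∨-monotonic)
  open MeetSemilatticeProperties meetSemilattice using (∧-monotonic)
  open ≤-Reasoning poset

  x≤x′′ : ∀ {x} → x ≤ x ′ ′
  x≤x′′ = reflexive (Eq.sym (involutive _))

  x′′≤x : ∀ {x} → x ′ ′ ≤ x
  x′′≤x = reflexive (involutive _)

  ′-reflects-≤ : ∀ {x y} → x ′ ≤ y ′ → y ≤ x
  ′-reflects-≤ p = trans x≤x′′ (trans (antitone p) x′′≤x)

  x≤y′⇒y≤x′ : ∀ {x y} → x ≤ y ′ → y ≤ x ′
  x≤y′⇒y≤x′ p = trans x≤x′′ (antitone p)

  [x∧y]′≤x′∨y′ : ∀ {x y} → (x ∧ y) ′ ≤ x ′ ∨ y ′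
  [x∧y]′≤x′∨y′ {x} {y} = trans (antitone (∧-greatest (trans (antitone (x≤x∨y (x ′) (y ′))) x′′≤x)
                                                      (trans (antitone (y≤x∨y (x ′) (y ′))) x′′≤x)))
                               x′′≤x

  x′∧y′≤[x∨y]′ : ∀ {x y} → x ′ ∧ y ′ ≤ (x ∨ y) ′
  x′∧y′≤[x∨y]′ {x} {y} = x≤y′⇒y≤x′ (∨-least (x≤y′⇒y≤x′ (x∧y≤x (x ′) (y ′)))
                                           (x≤y′⇒y≤x′ (x∧y≤y (x ′) (y ′))))

  x∨[y∧x′]≤y∧[x∨x′] : ∀ {x y} → x ≤ y → x ∨ (y ∧ x ′) ≤ y ∧ (x ∨ x ′)
  x∨[y∧x′]≤y∧[x∨x′] x≤y =
    ∨-least (∧-greatest x≤y (x≤x∨y _ _)) (∧-monotonic refl (y≤x∨y _ _))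

  [x∧x′]∨[y∧y′]≤[y∧[x∨x′]]′ : ∀ {x y} → (x ∧ x ′) ∨ (y ∧ y ′) ≤ (y ∧ (x ∨ x ′)) ′
  [x∧x′]∨[y∧y′]≤[y∧[x∨x′]]′ =
    ∨-least (trans (∧-greatest (x∧y≤y _ _) (trans (x∧y≤x _ _) x≤x′′))
                   (trans x′∧y′≤[x∨y]′ (antitone (x∧y≤y _ _))))
            (trans (x∧y≤y _ _) (antitone (x∧y≤x _ _)))

  [x∧x′]∨[y∧y′]≤[x′∧y]∧[x′∧y]′ : ∀ {x y} → x ≤ y →
    (x ∧ x ′) ∨ (y ∧ y ′) ≤ (x ′ ∧ y) ∧ (x ′ ∧ y) ′
  [x∧x′]∨[y∧y′]≤[x′∧y]∧[x′∧y]′ x≤y = ∨-least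
    (∧-greatest (∧-greatest (x∧y≤y _ _) (trans (x∧y≤x _ _) x≤y))
                (trans (x∧y≤x _ _) (x≤y′⇒y≤x′ (x∧y≤x _ _))))
    (∧-greatest (∧-greatest (trans (x∧y≤y _ _) (antitone x≤y)) (x∧y≤x _ _))
                (trans (x∧y≤y _ _) (antitone (x∧y≤y _ _))))

  ComparableIdentity : Set (c ⊔ ℓ₂)
  ComparableIdentity = ∀ {x y} → x ≤ y → y ∧ (x ∨ x ′) ≤ x ∨ (y ∧ x ′)

  identity⇒comparableIdentity : Identity A → ComparableIdentity
  identity⇒comparableIdentity identity {x} {y} x≤y = begin
    y ∧ (x ∨ x ′)        ≤⟨ ∧-monotonic (y≤x∨y x y) refl ⟩
    (x ∨ y) ∧ (x ∨ x ′)  ≈⟨ identity x y ⟩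
    x ∨ ((x ∨ y) ∧ x ′)  ≤⟨ ∨-monotonic refl (∧-monotonic (∨-least x≤y refl) refl) ⟩
    x ∨ (y ∧ x ′)        ∎

  comparableIdentity⇒identity : ComparableIdentity → Identity A
  comparableIdentity⇒identity ci x y =
    antisym (ci (x≤x∨y x y)) (x∨[y∧x′]≤y∧[x∨x′] (x≤x∨y x y))

  comparableIdentity⇒dual : ComparableIdentity →
    ∀ {x y} → x ≤ y → y ∧ (x ∨ y ′) ≤ x ∨ (y ∧ y ′)
  comparableIdentity⇒dual ci {x} {y} x≤y = ′-reflects-≤ (begin
    (x ∨ (y ∧ y ′)) ′    ≤⟨ ∧-greatest (antitone (x≤x∨y _ _)) (antitone (y≤x∨y _ _)) ⟩
    x ′ ∧ (y ∧ y ′) ′    ≤⟨ ∧-monotonic refl [x∧y]′≤x′∨y′ ⟩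
    x ′ ∧ (y ′ ∨ y ′ ′)  ≤⟨ ci (antitone x≤y) ⟩
    y ′ ∨ (x ′ ∧ y ′ ′)  ≤⟨ ∨-least (antitone (x∧y≤x _ _))
                                   (trans x′∧y′≤[x∨y]′ (antitone (x∧y≤y _ _))) ⟩
    (y ∧ (x ∨ y ′)) ′    ∎)

  comparableIdentity⇒sp1 : ComparableIdentity → SP1 A
  comparableIdentity⇒sp1 ci x y x≤y premise = antisym (begin
    y ∧ (x ∨ x ′)                ≤⟨ ci x≤y ⟩
    x ∨ (y ∧ x ′)                ≤⟨ ∨-monotonic refl (∧-greatest (x∧y≤y _ _) (x∧y≤x _ _)) ⟩
    x ∨ (x ′ ∧ y)                ≤⟨ ∨-monotonic refl (reflexive premise) ⟩
    x ∨ (x ∧ x ′) ∨ (y ∧ y ′)    ≤⟨ ∨-least (x≤x∨y _ _)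
                                      (∨-monotonic (x∧y≤x _ _) refl) ⟩
    x ∨ (y ∧ y ′)                ∎)
    (trans (∨-monotonic refl (∧-monotonic refl (antitone x≤y))) (x∨[y∧x′]≤y∧[x∨x′] x≤y))

  comparableIdentity⇒sp2 : ComparableIdentity → SP2 A
  comparableIdentity⇒sp2 ci x y x≤y = antisym ([x∧x′]∨[y∧y′]≤[x′∧y]∧[x′∧y]′ x≤y) (begin
    (x ′ ∧ y) ∧ (x ′ ∧ y) ′      ≤⟨ ∧-monotonic refl [x∧y]′≤x′∨y′ ⟩
    (x ′ ∧ y) ∧ (x ′ ′ ∨ y ′)    ≤⟨ ∧-greatest (trans (x∧y≤x _ _) (x∧y≤x _ _))
                                     (∧-monotonic (x∧y≤y _ _) (∨-monotonic x′′≤x refl)) ⟩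
    x ′ ∧ y ∧ (x ∨ y ′)          ≤⟨ ∧-monotonic refl (dual x≤y) ⟩
    x ′ ∧ (x ∨ (y ∧ y ′))        ≤⟨ ∧-monotonic refl (∨-least (trans x≤x′′ (y≤x∨y _ _)) (x≤x∨y _ _)) ⟩
    x ′ ∧ ((y ∧ y ′) ∨ x ′ ′)    ≤⟨ dual (trans (x∧y≤y _ _) (antitone x≤y)) ⟩
    (y ∧ y ′) ∨ (x ′ ∧ x ′ ′)    ≤⟨ ∨-least (y≤x∨y _ _)
                                     (trans (∧-greatest (trans (x∧y≤y _ _) x′′≤x) (x∧y≤x _ _)) (x≤x∨y _ _)) ⟩
    (x ∧ x ′) ∨ (y ∧ y ′)        ∎)
    where dual = comparableIdentity⇒dual ci

  -- (SP2) rewrites the premise of (SP1) as t ≈ t ∧ t′ for t = x′ ∧ y.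
  sp⇒sp1-conclusion : SP1 A → SP2 A → ∀ {x y} → x ≤ y → x ′ ∧ y ≤ (x ′ ∧ y) ′ →
    y ∧ (x ∨ x ′) ≈ x ∨ (y ∧ y ′)
  sp⇒sp1-conclusion sp1 sp2 {x} {y} x≤y t≤t′ = sp1 x y x≤y (antisym
    (trans (∧-greatest refl t≤t′) (reflexive (Eq.sym (sp2 x y x≤y))))
    (trans (reflexive (sp2 x y x≤y)) (x∧y≤x _ _)))

  sp⇒comparableIdentity : SP1 A → SP2 A → ComparableIdentity
  sp⇒comparableIdentity sp1 sp2 {x} {z} x≤z = begin
    z ∧ (x ∨ x ′)  ≤⟨ ∧-greatest (x∧y≤x _ _) z∧[x∨x′]≤w∨w′ ⟩
    z ∧ (w ∨ w ′)  ≈⟨ sp⇒sp1-conclusion sp1 sp2 w≤z t≤t′ ⟩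
    w ∨ (z ∧ z ′)  ≤⟨ ∨-least refl (trans (∧-monotonic refl (antitone x≤z)) (y≤x∨y _ _)) ⟩
    w              ∎
    where
    w = x ∨ (z ∧ x ′)

    w≤z : w ≤ z
    w≤z = ∨-least x≤z (x∧y≤x _ _)

    t≤z∧x′ : w ′ ∧ z ≤ z ∧ x ′
    t≤z∧x′ = ∧-greatest (x∧y≤y _ _) (trans (x∧y≤x _ _) (antitone (x≤x∨y _ _)))

    t≤t′ : w ′ ∧ z ≤ (w ′ ∧ z) ′
    t≤t′ = trans (trans (x∧y≤x _ _) (antitone (y≤x∨y _ _))) (antitone t≤z∧x′)

    w∧w′≤[z∧[x∨x′]]′ : w ∧ w ′ ≤ (z ∧ (x ∨ x ′)) ′
    w∧w′≤[z∧[x∨x′]]′ = begin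
      w ∧ w ′                  ≤⟨ ∧-greatest
                                   (∧-greatest (trans (x∧y≤y _ _) (antitone (x≤x∨y _ _)))
                                               (trans (x∧y≤x _ _) w≤z))
                                   (trans (x∧y≤y _ _)
                                          (antitone (trans (∧-greatest (x∧y≤y _ _) (x∧y≤x _ _))
                                                           (y≤x∨y _ _)))) ⟩
      (x ′ ∧ z) ∧ (x ′ ∧ z) ′  ≈⟨ sp2 x z x≤z ⟨
      (x ∧ x ′) ∨ (z ∧ z ′)    ≤⟨ [x∧x′]∨[y∧y′]≤[y∧[x∨x′]]′ ⟩
      (z ∧ (x ∨ x ′)) ′        ∎

    z∧[x∨x′]≤w∨w′ : z ∧ (x ∨ x ′) ≤ w ∨ w ′
    z∧[x∨x′]≤w∨w′ = begin
      z ∧ (x ∨ x ′)  ≤⟨ x≤y′⇒y≤x′ w∧w′≤[z∧[x∨x′]]′ ⟩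
      (w ∧ w ′) ′    ≤⟨ [x∧y]′≤x′∨y′ ⟩
      w ′ ∨ w ′ ′    ≤⟨ ∨-least (y≤x∨y _ _) (trans x′′≤x (x≤x∨y _ _)) ⟩
      w ∨ w ′        ∎

theorem3p5 : ∀ {c ℓ₁ ℓ₂ : Level} (A : PseudoKleeneLattice c ℓ₁ ℓ₂) →
    SpOrthomodular A ⇔ Identity A
theorem3p5 A = mk⇔
  (λ (sp1 , sp2) → comparableIdentity⇒identity (sp⇒comparableIdentity sp1 sp2))
  (λ identity → let ci = identity⇒comparableIdentity identity
                in comparableIdentity⇒sp1 ci , comparableIdentity⇒sp2 ci)
  where open SpOrthomodularity A
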